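{- Let $n\ge 2$ and let $x^\Lambda\partial_k,\,x^\Theta\partial_u\in\mathcal{B}$ be such that $[x^\Lambda\partial_k,x^\Theta\partial_u]\neq 0$. Then for every integer $i\ge -1$, \[\mathrm{lev}_i([x^\Lambda\partial_k,x^\Theta\partial_u])=\mathrm{lev}_i(x^\Lambda\partial_k)+\mathrm{lev}_i(x^\Theta\partial_u)-h_i(n-1),\] and \[\mathrm{WD}([x^\Lambda\partial_k,x^\Theta\partial_u])=\mathrm{WD}(x^\Lambda\partial_k)+\mathrm{WD}(x^\Theta\partial_u)-(n-1).\] Moreover, if $\mathrm{lev}_i(x^\Lambda\partial_k)\le i$ and $\mathrm{lev}_j(x^\Theta\partial_u)\le j$ for some integers $i,j\ge -1$, then \[\mathrm{WD}([x^\Lambda\partial_k,x^\Theta\partial_u])\le\min\bigl(\mathrm{WD}(x^\Lambda\partial_k),\mathrm{WD}(x^\Theta\partial_u)\bigr),\] with equality if and only if one of $x^\Lambda\partial_k$, $x^\Theta\partial_u$ is $\partial_1$.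
   Context: Let $n\ge 2$ be an integer. A partition is a sequence $\Lambda=(\lambda_t)_{t\ge 1}$ of non-negative integers with finite support; $\mathrm{wt}(\Lambda)=\sum_t t\lambda_t$; $x^\Lambda=\prod_t x_t^{\lambda_t}$ (monomial in commuting indeterminates), $\deg(x^\Lambda)=\sum_t\lambda_t$. $\mathrm{Part}(j)$ is the set of partitions with $\lambda_t=0$ for $t>j$; $\partial_k$ is the partial derivative with respect to $x_k$. Let $\mathcal{B}=\{x^\Lambda\partial_k:1\le k\le n,\ \Lambda\in\mathrm{Part}(k-1)\}$, and let $\mathfrak{L}(n)$ be the free $\mathbb{Z}$-module with basis $\mathcal{B}$, with Lie bracket defined on $\mathcal{B}$ by $[x^\Lambda\partial_k,x^\Theta\partial_j]=\partial_j(x^\Lambda)x^\Theta\partial_k$ if $j<k$, $=-x^\Lambda\partial_k(x^\Theta)\partial_j$ if $j>k$, $=0$ if $j=k$; thus the bracket of two basis elements is an integer multiple $c\,b$ of a basis element $b$. For an integer $i\ge -1$ let $r_i\in\{1,\dots,n-1\}$ with $i\equiv r_i\pmod{n-1}$ and $h_i=\lfloor (i-1)/(n-1)\rfloor+1$. For $x^\Lambda\partial_k\in\mathcal{B}$ and a nonzero integer $c$ define $\mathrm{WD}(c\,x^\Lambda\partial_k)=\mathrm{wt}(\Lambda)-\deg(x^\Lambda)+n-k$ and $\mathrm{lev}_i(c\,x^\Lambda\partial_k)=h_i\,\mathrm{WD}(x^\Lambda\partial_k)+\deg(x^\Lambda)-1$. -}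

module Defs where

open import Data.Nat as ℕ using (ℕ; zero; suc; _∸_; _<ᵇ_)
open import Data.Bool using (if_then_else_)
open import Data.List using (List; []; _∷_)
open import Data.Nat.ListAction using (sum)
open import Data.Integer as ℤ using (ℤ; +_; -_; _/ℕ_)
open import Data.Product using (_×_; _,_; proj₁; proj₂)
open import Relation.Binary.PropositionalEquality using (_≡_)

-- A partition Λ = (λ_t)_{t ≥ 1} with finite support is represented by the
-- list [λ_1 , λ_2 , … , λ_m] (entries beyond the list are 0).
Partition : Set
Partition = List ℕ

-- λ_t  (t ≥ 1); index 0 is unused and gives 0.
coeff : Partition → ℕ → ℕ
coeff []       _             = 0
coeff (x ∷ xs) zero          = 0
coeff (x ∷ xs) (suc zero)    = x
coeff (x ∷ xs) (suc (suc t)) = coeff xs (suc t)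

InPart : ℕ → Partition → Set
InPart j Λ = ∀ t → j ℕ.< t → coeff Λ t ≡ 0

wtFrom : ℕ → Partition → ℕ
wtFrom s []       = 0
wtFrom s (x ∷ xs) = s ℕ.* x ℕ.+ wtFrom (suc s) xs

wt : Partition → ℕ
wt = wtFrom 1

deg : Partition → ℕ
deg = sum

addP : Partition → Partition → Partition
addP []       ys       = ys
addP (x ∷ xs) []       = x ∷ xs
addP (x ∷ xs) (y ∷ ys) = (x ℕ.+ y) ∷ addP xs ys

-- Λ - e_t  (truncated; only used when λ_t ≥ 1, otherwise the coefficient is 0)
decAt : ℕ → Partition → Partition
decAt _             []       = []
decAt zero          (x ∷ xs) = x ∷ xs
decAt (suc zero)    (x ∷ xs) = (x ∸ 1) ∷ xs
decAt (suc (suc t)) (x ∷ xs) = x ∷ decAt (suc t) xs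

-- x^Λ ∂_k  is represented by the pair (Λ , k)
Mon : Set
Mon = Partition × ℕ

InB : ℕ → Mon → Set
InB n (Λ , k) = (1 ℕ.≤ k) × (k ℕ.≤ n) × InPart (k ∸ 1) Λ

Is∂₁ : Mon → Set
Is∂₁ (Λ , k) = (k ≡ 1) × (∀ t → coeff Λ t ≡ 0)

-- the bracket of two basis elements, as a pair (c , b) meaning c·b
--   [x^Λ∂_k, x^Θ∂_j] = λ_j x^(Λ-e_j+Θ) ∂_k          if j < k
--                    = - θ_k x^(Λ+Θ-e_k) ∂_j        if j > k
--                    = 0                            if j = k
bracket : Mon → Mon → ℤ × Mon
bracket (Λ , k) (Θ , j) =
  if j <ᵇ k then (+ coeff Λ j , (addP (decAt j Λ) Θ , k))
  else if k <ᵇ j then (- (+ coeff Θ k) , (addP Λ (decAt k Θ) , j))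
  else (+ 0 , (Λ , k))

WD : ℕ → Mon → ℤ
WD n (Λ , k) = (+ wt Λ) ℤ.- (+ deg Λ) ℤ.+ (+ n) ℤ.- (+ k)

-- h_i = ⌊(i-1)/(n-1)⌋ + 1 ; for n ≥ 2 we have suc (n ∸ 2) = n - 1,
-- and _/ℕ_ on ℤ is floor division (remainder in [0, n-1)).
h : ℕ → ℤ → ℤ
h n i = ((i ℤ.- ℤ.+ 1) /ℕ suc (n ∸ 2)) ℤ.+ ℤ.+ 1

lev : ℕ → ℤ → Mon → ℤ
lev n i (Λ , k) = h n i ℤ.* WD n (Λ , k) ℤ.+ (+ deg Λ) ℤ.- ℤ.+ 1

-- Write WD(x^Λ ∂_k) = e(Λ) + n - k with e(Λ) = wt Λ - deg Λ = Σ_t (t - 1) λ_t.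
-- The excess e is additive in Λ and drops by t - 1 when one factor x_t is removed;
-- a nonzero bracket removes one x_t, t being the index of the other derivation,
-- which gives the additivity of WD and, since deg drops by one, of lev_i.
-- For the bound, lev_i(x^Λ ∂_k) ≤ i forces WD(x^Λ ∂_k) ≤ n - 1 with equality only
-- for ∂_1: if k ≥ 2 and e(Λ) ≥ k - 1, then Λ ∈ Part(k - 1) gives
-- e(Λ) ≤ (k - 2) deg Λ, so deg Λ ≥ 2 and k ≥ 3; but then h_i ≥ 0 and
-- lev_i ≥ h_i (n - 1) + 1 > i.  Now WD[a,b] = WD a + WD b - (n - 1) ≤ min(WD a, WD b),
-- with equality exactly when one of WD a, WD b equals n - 1.
module Submission where

open import Defs
open import Data.Nat as ℕ using (ℕ; zero; suc; _∸_; _<ᵇ_; z≤n; s≤s)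
import Data.Nat.Properties as ℕP
import Data.Nat.Tactic.RingSolver as ℕ-Solver
open import Data.Integer as ℤ using (ℤ; +_; -[1+_]; _⊓_; _+_; _-_; _*_; -_; _≤_; _<_; +≤+; -≤-)
import Data.Integer.Properties as ℤP
open import Algebra.Properties.CommutativeSemigroup ℕP.+-commutativeSemigroup using (interchange)
open import Data.Integer.DivMod using (n<s[n/ℕd]*d)
open import Data.Integer.Tactic.RingSolver using (solve-∀)
open import Data.Bool using (true; false)
open import Data.List using ([]; _∷_)
open import Data.Empty using (⊥-elim)
open import Data.Product using (_×_; _,_; proj₁; proj₂)
open import Data.Sum using (_⊎_; inj₁; inj₂)
open import Data.Sum.Function.Propositional using (_⊎-⇔_)
open import Function using (_∘_)
open import Function.Bundles using (_⇔_; mk⇔)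
open import Function.Properties.Equivalence using () renaming (trans to ⇔-trans)
open import Relation.Nullary using (yes; no; contradiction)
open import Relation.Binary.PropositionalEquality
  using (_≡_; _≢_; refl; sym; trans; cong; cong₂; module ≡-Reasoning)

coeff-zero : ∀ Λ → coeff Λ 0 ≡ 0
coeff-zero []      = refl
coeff-zero (_ ∷ _) = refl

InPart-tail : ∀ {j x} Λ → InPart j (x ∷ Λ) → InPart (j ∸ 1) Λ
InPart-tail Λ p zero    _  = coeff-zero Λ
InPart-tail {zero}  Λ p (suc t) _  = p (suc (suc t)) (s≤s z≤n)
InPart-tail {suc j} Λ p (suc t) lt = p (suc (suc t)) (s≤s lt)

InPart-zero : ∀ s Λ → InPart 0 Λ → (wtFrom s Λ ≡ 0) × (deg Λ ≡ 0)
InPart-zero s []      p = refl , refl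
InPart-zero s (x ∷ Λ) p with p 1 (s≤s z≤n) | InPart-zero (suc s) Λ (InPart-tail Λ p)
... | refl | wt≡0 , deg≡0 = cong₂ ℕ._+_ (ℕP.*-zeroʳ s) wt≡0 , deg≡0

wtFrom-≤ : ∀ j s Λ → InPart j Λ → wtFrom (suc s) Λ ℕ.≤ (s ℕ.+ j) ℕ.* deg Λ
wtFrom-≤ zero    s Λ       p = ℕP.≤-trans (ℕP.≤-reflexive (proj₁ (InPart-zero (suc s) Λ p))) z≤n
wtFrom-≤ (suc j) s []      p = z≤n
wtFrom-≤ (suc j) s (x ∷ Λ) p = begin
  suc s ℕ.* x ℕ.+ wtFrom (suc (suc s)) Λ
    ≤⟨ ℕP.+-mono-≤ (ℕP.*-monoˡ-≤ x (ℕP.m≤m+n (suc s) j)) (wtFrom-≤ j (suc s) Λ (InPart-tail Λ p)) ⟩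
  (suc s ℕ.+ j) ℕ.* x ℕ.+ (suc s ℕ.+ j) ℕ.* deg Λ
    ≡⟨ ℕP.*-distribˡ-+ (suc s ℕ.+ j) x (deg Λ) ⟨
  (suc s ℕ.+ j) ℕ.* (x ℕ.+ deg Λ)
    ≡⟨ cong (ℕ._* (x ℕ.+ deg Λ)) (ℕP.+-suc s j) ⟨
  (s ℕ.+ suc j) ℕ.* (x ℕ.+ deg Λ) ∎
  where open ℕP.≤-Reasoning

wt≤*deg : ∀ j Λ → InPart j Λ → wt Λ ℕ.≤ j ℕ.* deg Λ
wt≤*deg j = wtFrom-≤ j 0

wtFrom-addP : ∀ s A B → wtFrom s (addP A B) ≡ wtFrom s A ℕ.+ wtFrom s B
wtFrom-addP s []      B       = refl
wtFrom-addP s (x ∷ A) []      = sym (ℕP.+-identityʳ _)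
wtFrom-addP s (x ∷ A) (y ∷ B) = begin
  s ℕ.* (x ℕ.+ y) ℕ.+ wtFrom (suc s) (addP A B)
    ≡⟨ cong (s ℕ.* (x ℕ.+ y) ℕ.+_) (wtFrom-addP (suc s) A B) ⟩
  s ℕ.* (x ℕ.+ y) ℕ.+ (wtFrom (suc s) A ℕ.+ wtFrom (suc s) B)
    ≡⟨ cong (ℕ._+ (wtFrom (suc s) A ℕ.+ wtFrom (suc s) B)) (ℕP.*-distribˡ-+ s x y) ⟩
  (s ℕ.* x ℕ.+ s ℕ.* y) ℕ.+ (wtFrom (suc s) A ℕ.+ wtFrom (suc s) B)
    ≡⟨ interchange (s ℕ.* x) (s ℕ.* y) _ _ ⟩
  (s ℕ.* x ℕ.+ wtFrom (suc s) A) ℕ.+ (s ℕ.* y ℕ.+ wtFrom (suc s) B) ∎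
  where open ≡-Reasoning

deg-addP : ∀ A B → deg (addP A B) ≡ deg A ℕ.+ deg B
deg-addP []      B       = refl
deg-addP (x ∷ A) []      = sym (ℕP.+-identityʳ _)
deg-addP (x ∷ A) (y ∷ B) = begin
  (x ℕ.+ y) ℕ.+ deg (addP A B)   ≡⟨ cong ((x ℕ.+ y) ℕ.+_) (deg-addP A B) ⟩
  (x ℕ.+ y) ℕ.+ (deg A ℕ.+ deg B) ≡⟨ interchange x y (deg A) (deg B) ⟩
  (x ℕ.+ deg A) ℕ.+ (y ℕ.+ deg B) ∎
  where open ≡-Reasoning

wtFrom-decAt : ∀ s t Λ → coeff Λ (suc t) ≢ 0 →
  wtFrom s (decAt (suc t) Λ) ℕ.+ (s ℕ.+ t) ≡ wtFrom s Λ
wtFrom-decAt s t       []            λ≢0 = ⊥-elim (λ≢0 refl)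
wtFrom-decAt s zero    (zero  ∷ Λ)   λ≢0 = ⊥-elim (λ≢0 refl)
wtFrom-decAt s zero    (suc x ∷ Λ)   λ≢0 = shift s x (wtFrom (suc s) Λ)
  where
  shift : ∀ s x w → s ℕ.* x ℕ.+ w ℕ.+ (s ℕ.+ 0) ≡ s ℕ.* suc x ℕ.+ w
  shift = ℕ-Solver.solve-∀
wtFrom-decAt s (suc t) (x ∷ Λ)       λ≢0 = begin
  s ℕ.* x ℕ.+ wtFrom (suc s) (decAt (suc t) Λ) ℕ.+ (s ℕ.+ suc t)
    ≡⟨ cong (λ c → s ℕ.* x ℕ.+ wtFrom (suc s) (decAt (suc t) Λ) ℕ.+ c) (ℕP.+-suc s t) ⟩
  s ℕ.* x ℕ.+ wtFrom (suc s) (decAt (suc t) Λ) ℕ.+ (suc s ℕ.+ t)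
    ≡⟨ ℕP.+-assoc (s ℕ.* x) _ _ ⟩
  s ℕ.* x ℕ.+ (wtFrom (suc s) (decAt (suc t) Λ) ℕ.+ (suc s ℕ.+ t))
    ≡⟨ cong (s ℕ.* x ℕ.+_) (wtFrom-decAt (suc s) t Λ λ≢0) ⟩
  s ℕ.* x ℕ.+ wtFrom (suc s) Λ ∎
  where open ≡-Reasoning

deg-decAt : ∀ t Λ → coeff Λ (suc t) ≢ 0 → deg (decAt (suc t) Λ) ℕ.+ 1 ≡ deg Λ
deg-decAt t       []          λ≢0 = ⊥-elim (λ≢0 refl)
deg-decAt zero    (zero  ∷ Λ) λ≢0 = ⊥-elim (λ≢0 refl)
deg-decAt zero    (suc x ∷ Λ) λ≢0 = ℕP.+-comm (x ℕ.+ deg Λ) 1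
deg-decAt (suc t) (x ∷ Λ)     λ≢0 =
  trans (ℕP.+-assoc x _ 1) (cong (x ℕ.+_) (deg-decAt t Λ λ≢0))

excess : Partition → ℤ
excess Λ = + wt Λ - + deg Λ

excess-addP : ∀ A B → excess (addP A B) ≡ excess A + excess B
excess-addP A B = begin
  + wt (addP A B) - + deg (addP A B)
    ≡⟨ cong₂ (λ w d → + w - + d) (wtFrom-addP 1 A B) (deg-addP A B) ⟩
  (+ wt A + + wt B) - (+ deg A + + deg B)
    ≡⟨ regroup (+ wt A) (+ wt B) (+ deg A) (+ deg B) ⟩
  excess A + excess B ∎
  where
  open ≡-Reasoning
  regroup : ∀ a b c d → (a + b) - (c + d) ≡ (a - c) + (b - d)
  regroup = solve-∀

excess-decAt : ∀ t Λ → coeff Λ (suc t) ≢ 0 → excess (decAt (suc t) Λ) ≡ excess Λ - + t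
excess-decAt t Λ λ≢0 = begin
  + wt D - + deg D
    ≡⟨ shift (+ wt D) (+ deg D) (+ t) ⟩
  (+ wt D + (+ 1 + + t)) - (+ deg D + + 1) - + t
    ≡⟨ cong₂ (λ w d → + w - + d - + t) (wtFrom-decAt 1 t Λ λ≢0) (deg-decAt t Λ λ≢0) ⟩
  excess Λ - + t ∎
  where
  open ≡-Reasoning
  D : Partition
  D = decAt (suc t) Λ
  shift : ∀ w d t → w - d ≡ (w + (+ 1 + t)) - (d + + 1) - t
  shift = solve-∀

-- From here on `suc n` plays the role of the paper's n, so that n is n - 1.
Additive : ℕ → Mon → Mon → Mon → Set
Additive n (Λ , k) (Θ , u) (Γ , m) =
  (WD (suc n) (Γ , m) ≡ WD (suc n) (Λ , k) + WD (suc n) (Θ , u) - + n) ×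
  (+ deg Γ ≡ + deg Λ + + deg Θ - + 1)

Additive-decAtˡ : ∀ n Λ k Θ t → coeff Λ (suc t) ≢ 0 →
  Additive n (Λ , k) (Θ , suc t) (addP (decAt (suc t) Λ) Θ , k)
Additive-decAtˡ n Λ k Θ t λ≢0 = WD-eq , deg-eq
  where
  open ≡-Reasoning
  regroup : ∀ a b t n k → a - t + b + (+ 1 + n) - k ≡ (a + (+ 1 + n) - k) + (b + (+ 1 + n) - (+ 1 + t)) - n
  regroup = solve-∀
  shift : ∀ a b → a + b ≡ a + + 1 + b - + 1
  shift = solve-∀
  D : Partition
  D = decAt (suc t) Λ
  WD-eq : WD (suc n) (addP D Θ , k) ≡ WD (suc n) (Λ , k) + WD (suc n) (Θ , suc t) - + n
  WD-eq = begin
    excess (addP D Θ) + + suc n - + k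
      ≡⟨ cong (λ e → e + + suc n - + k) (excess-addP D Θ) ⟩
    excess D + excess Θ + + suc n - + k
      ≡⟨ cong (λ e → e + excess Θ + + suc n - + k) (excess-decAt t Λ λ≢0) ⟩
    excess Λ - + t + excess Θ + (+ 1 + + n) - + k
      ≡⟨ regroup (excess Λ) (excess Θ) (+ t) (+ n) (+ k) ⟩
    WD (suc n) (Λ , k) + WD (suc n) (Θ , suc t) - + n ∎
  deg-eq : + deg (addP D Θ) ≡ + deg Λ + + deg Θ - + 1
  deg-eq = begin
    + deg (addP D Θ)             ≡⟨ cong +_ (deg-addP D Θ) ⟩
    + deg D + + deg Θ            ≡⟨ shift (+ deg D) (+ deg Θ) ⟩
    + deg D + + 1 + + deg Θ - + 1 ≡⟨ cong (λ d → + d + + deg Θ - + 1) (deg-decAt t Λ λ≢0) ⟩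
    + deg Λ + + deg Θ - + 1      ∎

Additive-decAtʳ : ∀ n Λ Θ u t → coeff Θ (suc t) ≢ 0 →
  Additive n (Λ , suc t) (Θ , u) (addP Λ (decAt (suc t) Θ) , u)
Additive-decAtʳ n Λ Θ u t θ≢0 = WD-eq , deg-eq
  where
  open ≡-Reasoning
  regroup : ∀ a b t n u → a + (b - t) + (+ 1 + n) - u ≡ (a + (+ 1 + n) - (+ 1 + t)) + (b + (+ 1 + n) - u) - n
  regroup = solve-∀
  shift : ∀ a b → a + b ≡ a + (b + + 1) - + 1
  shift = solve-∀
  D : Partition
  D = decAt (suc t) Θ
  WD-eq : WD (suc n) (addP Λ D , u) ≡ WD (suc n) (Λ , suc t) + WD (suc n) (Θ , u) - + n
  WD-eq = begin
    excess (addP Λ D) + + suc n - + u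
      ≡⟨ cong (λ e → e + + suc n - + u) (excess-addP Λ D) ⟩
    excess Λ + excess D + + suc n - + u
      ≡⟨ cong (λ e → excess Λ + e + + suc n - + u) (excess-decAt t Θ θ≢0) ⟩
    excess Λ + (excess Θ - + t) + (+ 1 + + n) - + u
      ≡⟨ regroup (excess Λ) (excess Θ) (+ t) (+ n) (+ u) ⟩
    WD (suc n) (Λ , suc t) + WD (suc n) (Θ , u) - + n ∎
  deg-eq : + deg (addP Λ D) ≡ + deg Λ + + deg Θ - + 1
  deg-eq = begin
    + deg (addP Λ D)               ≡⟨ cong +_ (deg-addP Λ D) ⟩
    + deg Λ + + deg D              ≡⟨ shift (+ deg Λ) (+ deg D) ⟩
    + deg Λ + (+ deg D + + 1) - + 1 ≡⟨ cong (λ d → + deg Λ + + d - + 1) (deg-decAt t Θ θ≢0) ⟩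
    + deg Λ + + deg Θ - + 1        ∎

bracket-Additive : ∀ n Λ k Θ u → proj₁ (bracket (Λ , k) (Θ , u)) ≢ + 0 →
  Additive n (Λ , k) (Θ , u) (proj₂ (bracket (Λ , k) (Θ , u)))
bracket-Additive n Λ k Θ u c≢0 with u <ᵇ k | k <ᵇ u
... | true  | _     = left u (c≢0 ∘ cong (+_))
  where
  left : ∀ u → coeff Λ u ≢ 0 → Additive n (Λ , k) (Θ , u) (addP (decAt u Λ) Θ , k)
  left zero    λ≢0 = ⊥-elim (λ≢0 (coeff-zero Λ))
  left (suc t) λ≢0 = Additive-decAtˡ n Λ k Θ t λ≢0
... | false | true  = right k (c≢0 ∘ cong (λ c → - (+ c)))
  where
  right : ∀ k → coeff Θ k ≢ 0 → Additive n (Λ , k) (Θ , u) (addP Λ (decAt k Θ) , u)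
  right zero    θ≢0 = ⊥-elim (θ≢0 (coeff-zero Θ))
  right (suc t) θ≢0 = Additive-decAtʳ n Λ Θ u t θ≢0
... | false | false = ⊥-elim (c≢0 refl)

lev-Additive : ∀ n i a b m → Additive n a b m →
  lev (suc n) i m ≡ lev (suc n) i a + lev (suc n) i b - h (suc n) i * + n
lev-Additive n i (Λ , k) (Θ , u) (Γ , m) (WD-eq , deg-eq) = begin
  H * WD (suc n) (Γ , m) + + deg Γ - + 1
    ≡⟨ cong₂ (λ w d → H * w + d - + 1) WD-eq deg-eq ⟩
  H * (WD (suc n) (Λ , k) + WD (suc n) (Θ , u) - + n) + (+ deg Λ + + deg Θ - + 1) - + 1
    ≡⟨ regroup H (WD (suc n) (Λ , k)) (WD (suc n) (Θ , u)) (+ n) (+ deg Λ) (+ deg Θ) ⟩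
  lev (suc n) i (Λ , k) + lev (suc n) i (Θ , u) - H * + n ∎
  where
  open ≡-Reasoning
  H : ℤ
  H = h (suc n) i
  regroup : ∀ H w₁ w₂ N d₁ d₂ →
    H * (w₁ + w₂ - N) + (d₁ + d₂ - + 1) - + 1 ≡ (H * w₁ + d₁ - + 1) + (H * w₂ + d₂ - + 1) - H * N
  regroup = solve-∀

i≤h*[n∸1] : ∀ n i → 2 ℕ.≤ n → i ≤ h n i * + (n ∸ 1)
i≤h*[n∸1] (suc (suc m)) i (s≤s (s≤s _)) = begin
  i                      ≡⟨ shift i ⟩
  + 1 + (i - + 1)        ≤⟨ ℤP.i<j⇒suc[i]≤j (n<s[n/ℕd]*d (i - + 1) (suc m)) ⟩
  ℤ.suc q * + suc m      ≡⟨ cong (_* + suc m) (ℤP.+-comm (+ 1) q) ⟩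
  (q + + 1) * + suc m    ∎
  where
  open ℤP.≤-Reasoning
  q : ℤ
  q = (i - + 1) ℤ./ℕ suc m
  shift : ∀ i → i ≡ + 1 + (i - + 1)
  shift = solve-∀

h-nonNeg : ∀ n i → 3 ℕ.≤ n → -[1+ 0 ] ≤ i → + 0 ≤ h n i
h-nonNeg (suc (suc (suc m))) i (s≤s (s≤s (s≤s _))) -1≤i =
  nonNeg (h (3 ℕ.+ m) i) (ℤP.≤-trans -1≤i (i≤h*[n∸1] (3 ℕ.+ m) i (s≤s (s≤s z≤n))))
  where
  nonNeg : ∀ H → -[1+ 0 ] ≤ H * + suc (suc m) → + 0 ≤ H
  nonNeg (+ _)     _         = +≤+ z≤n
  nonNeg -[1+ _ ] (-≤- ())

m+n≤m*n⇒2≤m×2≤n : ∀ m n → suc m ℕ.+ n ℕ.≤ suc m ℕ.* n → 2 ℕ.≤ suc m × 2 ℕ.≤ n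
m+n≤m*n⇒2≤m×2≤n m zero p =
  contradiction (ℕP.≤-trans p (ℕP.≤-reflexive (ℕP.*-zeroʳ (suc m)))) λ ()
m+n≤m*n⇒2≤m×2≤n m (suc zero) p =
  contradiction (ℕP.≤-trans p (ℕP.≤-reflexive (ℕP.*-identityʳ (suc m)))) (ℕP.m+1+n≰m (suc m))
m+n≤m*n⇒2≤m×2≤n zero (suc (suc n)) p =
  contradiction (ℕP.≤-trans p (ℕP.≤-reflexive (ℕP.*-identityˡ (suc (suc n))))) ℕP.1+n≰n
m+n≤m*n⇒2≤m×2≤n (suc m) (suc (suc n)) p = s≤s (s≤s z≤n) , s≤s (s≤s z≤n)

i<H*W+d-1 : ∀ {H W N i} d → + 0 ≤ H → N ≤ W → i ≤ H * N → 2 ℕ.≤ d → i < H * W + + d - + 1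
i<H*W+d-1 {H} {W} {N} {i} (suc (suc d)) 0≤H N≤W i≤HN (s≤s (s≤s _)) = ℤP.suc[i]≤j⇒i<j (begin
  + 1 + i             ≤⟨ ℤP.+-mono-≤ (+≤+ (s≤s z≤n)) i≤HN ⟩
  + suc d + H * N     ≤⟨ ℤP.+-monoʳ-≤ (+ suc d) (ℤP.*-monoˡ-≤-nonNeg H {{ℤ.nonNegative 0≤H}} N≤W) ⟩
  + suc d + H * W     ≡⟨ ℤP.+-comm (+ suc d) (H * W) ⟩
  H * W + + suc d     ≡⟨ ℤP.+-assoc (H * W) (+ suc (suc d)) (- + 1) ⟨
  H * W + + suc (suc d) - + 1 ∎)
  where open ℤP.≤-Reasoning

WD≡excess-[k∸1]+[n∸1] : ∀ n Λ j → WD (suc n) (Λ , suc (suc j)) ≡ excess Λ - + suc j + + n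
WD≡excess-[k∸1]+[n∸1] n Λ j = regroup (excess Λ) (+ j) (+ n)
  where
  regroup : ∀ e j n → e + (+ 1 + n) - (+ 1 + (+ 1 + j)) ≡ e - (+ 1 + j) + n
  regroup = solve-∀

lev≤⇒WD< : ∀ n Λ j → InPart (suc j) Λ → suc (suc j) ℕ.≤ suc n → ∀ i → -[1+ 0 ] ≤ i →
  lev (suc n) i (Λ , suc (suc j)) ≤ i → WD (suc n) (Λ , suc (suc j)) < + n
lev≤⇒WD< n Λ j p k≤n i -1≤i lev≤i with excess Λ ℤP.<? + suc j
... | yes e<k-1 = begin-strict
  WD (suc n) (Λ , suc (suc j)) ≡⟨ WD≡excess-[k∸1]+[n∸1] n Λ j ⟩
  excess Λ - + suc j + + n     <⟨ ℤP.+-monoˡ-< (+ n) (ℤP.+-monoˡ-< (- + suc j) e<k-1) ⟩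
  + suc j - + suc j + + n      ≡⟨ cong (_+ + n) (ℤP.+-inverseʳ (+ suc j)) ⟩
  + n                          ∎
  where open ℤP.≤-Reasoning
... | no e≮k-1 = contradiction lev≤i (ℤP.<⇒≱ (i<H*W+d-1 (deg Λ) 0≤h n≤WD i≤hn 2≤deg))
  where
  k-1≤e : + suc j ≤ excess Λ
  k-1≤e = ℤP.≮⇒≥ e≮k-1
  k-1+deg≤wt : suc j ℕ.+ deg Λ ℕ.≤ wt Λ
  k-1+deg≤wt = ℤP.drop‿+≤+ (begin
    + suc j + + deg Λ                ≤⟨ ℤP.+-monoˡ-≤ (+ deg Λ) k-1≤e ⟩
    + wt Λ - + deg Λ + + deg Λ       ≡⟨ cancel (+ wt Λ) (+ deg Λ) ⟩
    + wt Λ                           ∎)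
    where
    open ℤP.≤-Reasoning
    cancel : ∀ a b → a - b + b ≡ a
    cancel = solve-∀
  2≤k-1×2≤deg : 2 ℕ.≤ suc j × 2 ℕ.≤ deg Λ
  2≤k-1×2≤deg = m+n≤m*n⇒2≤m×2≤n j (deg Λ) (ℕP.≤-trans k-1+deg≤wt (wt≤*deg (suc j) Λ p))
  2≤deg : 2 ℕ.≤ deg Λ
  2≤deg = proj₂ 2≤k-1×2≤deg
  0≤h : + 0 ≤ h (suc n) i
  0≤h = h-nonNeg (suc n) i (ℕP.≤-trans (s≤s (proj₁ 2≤k-1×2≤deg)) k≤n) -1≤i
  i≤hn : i ≤ h (suc n) i * + n
  i≤hn = i≤h*[n∸1] (suc n) i (ℕP.≤-trans (s≤s (s≤s z≤n)) k≤n)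
  n≤WD : + n ≤ WD (suc n) (Λ , suc (suc j))
  n≤WD = begin
    + n                          ≡⟨ cong (_+ + n) (ℤP.+-inverseʳ (+ suc j)) ⟨
    + suc j - + suc j + + n      ≤⟨ ℤP.+-monoˡ-≤ (+ n) (ℤP.+-monoˡ-≤ (- + suc j) k-1≤e) ⟩
    excess Λ - + suc j + + n     ≡⟨ WD≡excess-[k∸1]+[n∸1] n Λ j ⟨
    WD (suc n) (Λ , suc (suc j)) ∎
    where open ℤP.≤-Reasoning

WD-∂₁ : ∀ n m → Is∂₁ m → WD (suc n) m ≡ + n
WD-∂₁ n (Λ , .1) (refl , coeff≡0) with InPart-zero 1 Λ (λ t _ → coeff≡0 t)
... | wt≡0 , deg≡0 = cong₂ (λ w d → + w - + d + + suc n - + 1) wt≡0 deg≡0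

lev≤⇒WD<⊎∂₁ : ∀ n m → InB (suc n) m → ∀ i → -[1+ 0 ] ≤ i → lev (suc n) i m ≤ i →
  WD (suc n) m < + n ⊎ Is∂₁ m
lev≤⇒WD<⊎∂₁ n (Λ , zero)          (() , _)
lev≤⇒WD<⊎∂₁ n (Λ , suc zero)      (_ , _ , p)    i _ _ = inj₂ (refl , coeff≡0)
  where
  coeff≡0 : ∀ t → coeff Λ t ≡ 0
  coeff≡0 zero    = coeff-zero Λ
  coeff≡0 (suc t) = p (suc t) (s≤s z≤n)
lev≤⇒WD<⊎∂₁ n (Λ , suc (suc j)) (_ , k≤n , p) i -1≤i lev≤i =
  inj₁ (lev≤⇒WD< n Λ j p k≤n i -1≤i lev≤i)

WD≤×WD≡⇔∂₁ : ∀ n m → WD (suc n) m < + n ⊎ Is∂₁ m →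
  WD (suc n) m ≤ + n × (WD (suc n) m ≡ + n ⇔ Is∂₁ m)
WD≤×WD≡⇔∂₁ n m (inj₁ WD<n) =
  ℤP.<⇒≤ WD<n , mk⇔ (contradiction WD<n ∘ ℤP.≤⇒≯ ∘ ℤP.≤-reflexive ∘ sym) (WD-∂₁ n m)
WD≤×WD≡⇔∂₁ n m (inj₂ ∂₁) = ℤP.≤-reflexive (WD-∂₁ n m ∂₁) , mk⇔ (λ _ → ∂₁) (WD-∂₁ n m)

i+j-j≡i : ∀ i j → i + j - j ≡ i
i+j-j≡i = solve-∀

i+j-i≡j : ∀ i j → i + j - i ≡ j
i+j-i≡j = solve-∀

i+j-n≤i⊓j : ∀ {i j n} → i ≤ n → j ≤ n → i + j - n ≤ i ⊓ j
i+j-n≤i⊓j {i} {j} {n} i≤n j≤n = ℤP.⊓-glb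
  (ℤP.≤-trans (ℤP.+-monoˡ-≤ (- n) (ℤP.+-monoʳ-≤ i j≤n)) (ℤP.≤-reflexive (i+j-j≡i i n)))
  (ℤP.≤-trans (ℤP.+-monoˡ-≤ (- n) (ℤP.+-monoˡ-≤ j i≤n)) (ℤP.≤-reflexive (i+j-i≡j n j)))

i+j-n≡i⇒j≡n : ∀ i j n → i + j - n ≡ i → j ≡ n
i+j-n≡i⇒j≡n i j n eq = begin
  j                   ≡⟨ regroup i j n ⟩
  (i + j - n) - i + n ≡⟨ cong (λ x → x - i + n) eq ⟩
  i - i + n           ≡⟨ cong (_+ n) (ℤP.+-inverseʳ i) ⟩
  + 0 + n             ≡⟨ ℤP.+-identityˡ n ⟩
  n                   ∎
  where
  open ≡-Reasoning
  regroup : ∀ i j n → j ≡ (i + j - n) - i + n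
  regroup = solve-∀

i+j-n≡i⊓j⇔ : ∀ {i j n} → i ≤ n → j ≤ n → (i + j - n ≡ i ⊓ j ⇔ (i ≡ n ⊎ j ≡ n))
i+j-n≡i⊓j⇔ {i} {j} {n} i≤n j≤n = mk⇔ to from
  where
  to : i + j - n ≡ i ⊓ j → i ≡ n ⊎ j ≡ n
  to eq with ℤP.≤-total i j
  ... | inj₁ i≤j = inj₂ (i+j-n≡i⇒j≡n i j n (trans eq (ℤP.i≤j⇒i⊓j≡i i≤j)))
  ... | inj₂ j≤i = inj₁ (i+j-n≡i⇒j≡n j i n (trans (cong (_- n) (ℤP.+-comm j i)) (trans eq (ℤP.i≥j⇒i⊓j≡j j≤i))))
  from : i ≡ n ⊎ j ≡ n → i + j - n ≡ i ⊓ j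
  from (inj₁ i≡n) = trans (cong (λ x → i + j - x) (sym i≡n))
    (trans (i+j-i≡j i j) (sym (ℤP.i≥j⇒i⊓j≡j (ℤP.≤-trans j≤n (ℤP.≤-reflexive (sym i≡n))))))
  from (inj₂ j≡n) = trans (cong (λ x → i + j - x) (sym j≡n))
    (trans (i+j-j≡i i j) (sym (ℤP.i≤j⇒i⊓j≡i (ℤP.≤-trans i≤n (ℤP.≤-reflexive (sym j≡n))))))

Additive⇒WD≤⊓ : ∀ n a b m → Additive n a b m →
  WD (suc n) a < + n ⊎ Is∂₁ a → WD (suc n) b < + n ⊎ Is∂₁ b →
  WD (suc n) m ≤ WD (suc n) a ⊓ WD (suc n) b ×
  (WD (suc n) m ≡ WD (suc n) a ⊓ WD (suc n) b ⇔ (Is∂₁ a ⊎ Is∂₁ b))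
Additive⇒WD≤⊓ n a b m (WD-eq , _) a-bound b-bound
  with WD≤×WD≡⇔∂₁ n a a-bound | WD≤×WD≡⇔∂₁ n b b-bound
... | WDa≤n , WDa≡n⇔∂₁ | WDb≤n , WDb≡n⇔∂₁ rewrite WD-eq =
  i+j-n≤i⊓j WDa≤n WDb≤n , ⇔-trans (i+j-n≡i⊓j⇔ WDa≤n WDb≤n) (WDa≡n⇔∂₁ ⊎-⇔ WDb≡n⇔∂₁)

proposition2p3 : (n : ℕ) → 2 ℕ.≤ n →
  (Λ : Partition) (k : ℕ) (Θ : Partition) (u : ℕ) →
  InB n (Λ , k) → InB n (Θ , u) →
  proj₁ (bracket (Λ , k) (Θ , u)) ≢ + 0 →
  ((i : ℤ) → -[1+ 0 ] ℤ.≤ i →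
     lev n i (proj₂ (bracket (Λ , k) (Θ , u)))
       ≡ lev n i (Λ , k) ℤ.+ lev n i (Θ , u) ℤ.- h n i ℤ.* (+ (n ∸ 1)))
  × (WD n (proj₂ (bracket (Λ , k) (Θ , u)))
       ≡ WD n (Λ , k) ℤ.+ WD n (Θ , u) ℤ.- (+ (n ∸ 1)))
  × ((i j : ℤ) → -[1+ 0 ] ℤ.≤ i → -[1+ 0 ] ℤ.≤ j →
     lev n i (Λ , k) ℤ.≤ i → lev n j (Θ , u) ℤ.≤ j →
     (WD n (proj₂ (bracket (Λ , k) (Θ , u))) ℤ.≤ WD n (Λ , k) ⊓ WD n (Θ , u))
     × ((WD n (proj₂ (bracket (Λ , k) (Θ , u))) ≡ WD n (Λ , k) ⊓ WD n (Θ , u))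
        ⇔ (Is∂₁ (Λ , k) ⊎ Is∂₁ (Θ , u))))
proposition2p3 (suc n) _ Λ k Θ u Λ∈B Θ∈B c≢0 =
  (λ i _ → lev-Additive n i (Λ , k) (Θ , u) Γ additive) ,
  proj₁ additive ,
  λ i j -1≤i -1≤j lev≤i lev≤j → Additive⇒WD≤⊓ n (Λ , k) (Θ , u) Γ additive
    (lev≤⇒WD<⊎∂₁ n (Λ , k) Λ∈B i -1≤i lev≤i)
    (lev≤⇒WD<⊎∂₁ n (Θ , u) Θ∈B j -1≤j lev≤j)
  where
  Γ : Mon
  Γ = proj₂ (bracket (Λ , k) (Θ , u))
  additive : Additive n (Λ , k) (Θ , u) Γ
  additive = bracket-Additive n Λ k Θ u c≢0
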